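{- Let $n\ge 1$. If $A$ is an ordered partition of $V(E_n)$, then $\mathcal A(A)$ is an ultrahomogeneous system of partitions of $E_n$. Moreover, if $\mathcal A(A)$ is non-trivial, $|\mathcal A(A)|\le n$, and $A$ has between $2$ and $3$ parts, then $A$ has exactly two parts, one of which is a singleton; in that case the permutation group induced by $\mathrm{Aut}(E_n)$ on $\mathcal A(A)$ is the full symmetric group $\mathrm{Sym}(n)$.
   Context: $E_n$ is the graph on $n$ vertices without arcs, regarded as a CCD with one vertex color and one edge color. For a CCD $G$ (vertex coloring $\chi_G$, edge coloring on ordered pairs of distinct vertices), ultrahomogeneity means every isomorphism between induced sub-CCDs extends to an automorphism. An ordered partition is a tuple $(P_1,\dots,P_k)$ of disjoint non-empty sets covering $V(G)$. For $\varphi\in\mathrm{Aut}(G)$, $\varphi(A)=(\varphi(P_1),\dots,\varphi(P_k))$ and $\mathcal A(A)=\{\varphi(A):\varphi\in\mathrm{Aut}(G)\}$. For ordered partitions $A_1,\dots,A_m$, $\chi_G(A_1,\dots,A_m)$ is the coloring $v\mapsto(\chi_G(v),i_1,\dots,i_m)$ where $v$ is in the $i_j$-th part of $A_j$. $\mathcal A(A)$ is an ultrahomogeneous system of partitions if for every finite sequence $A_1,\dots,A_m$ in $\mathcal A(A)$ the CCD $G$ recolored by $\chi_G(A_1,\dots,A_m)$ is ultrahomogeneous; it is non-trivial if $|\mathcal A(A)|\neq1$. -}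

module Defs where

open import Data.Nat using (ℕ; _≤_)
open import Data.Fin using (Fin)
open import Data.Fin.Permutation using (Permutation′; _⟨$⟩ʳ_; _⟨$⟩ˡ_)
open import Data.Vec using (Vec; tabulate)
open import Data.Unit using (⊤; tt)
open import Data.Product using (Σ; ∃; _×_; _,_)
open import Relation.Binary.PropositionalEquality using (_≡_; _≢_)
open import Relation.Nullary using (¬_)

-- A finite colored complete digraph (CCD) on vertex set Fin n:
-- a vertex coloring and an edge coloring of ordered pairs
-- (the value on pairs (v , v) is irrelevant and never used).
record CCD (n : ℕ) : Set₁ where
  field
    VColor : Set
    EColor : Set
    χ      : Fin n → VColor
    ε      : Fin n → Fin n → EColor
open CCD public

-- E_n : n vertices, no arcs; one vertex color and one edge color.
E : (n : ℕ) → CCD n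
E n = record { VColor = ⊤ ; EColor = ⊤ ; χ = λ _ → tt ; ε = λ _ _ → tt }

IsAut : ∀ {n} → CCD n → Permutation′ n → Set
IsAut G φ =
  (∀ v → χ G (φ ⟨$⟩ʳ v) ≡ χ G v) ×
  (∀ u v → u ≢ v → ε G (φ ⟨$⟩ʳ u) (φ ⟨$⟩ʳ v) ≡ ε G u v)

-- An isomorphism between induced sub-CCDs, given by enumerations
-- u, w : Fin m → Fin n (injective) of the two vertex subsets;
-- the isomorphism sends u i to w i.
record PartialIso {n} (G : CCD n) : Set where
  field
    m      : ℕ
    u      : Fin m → Fin n
    w      : Fin m → Fin n
    u-inj  : ∀ i j → u i ≡ u j → i ≡ j
    w-inj  : ∀ i j → w i ≡ w j → i ≡ j
    pres-χ : ∀ i → χ G (w i) ≡ χ G (u i)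
    pres-ε : ∀ i j → i ≢ j → ε G (w i) (w j) ≡ ε G (u i) (u j)

Ultrahomogeneous : ∀ {n} → CCD n → Set
Ultrahomogeneous {n} G =
  (f : PartialIso G) →
  Σ (Permutation′ n) λ φ → IsAut G φ × (∀ i → φ ⟨$⟩ʳ PartialIso.u f i ≡ PartialIso.w f i)

-- Ordered partitions of Fin n into k parts (P_1,...,P_k), encoded by the
-- part-index map p (P_i = p⁻¹(i)); parts non-empty = p surjective.
Partition : ℕ → ℕ → Set
Partition n k = Fin n → Fin k

_≈ₚ_ : ∀ {n k} → Partition n k → Partition n k → Set
p ≈ₚ q = ∀ v → p v ≡ q v

IsOrderedPartition : ∀ {n k} → Partition n k → Set
IsOrderedPartition {n} {k} p = ∀ (i : Fin k) → ∃ λ (v : Fin n) → p v ≡ i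

-- φ(A) = (φ(P_1),...,φ(P_k)):  v ∈ φ(P_i)  iff  φ⁻¹(v) ∈ P_i.
act : ∀ {n k} → Permutation′ n → Partition n k → Partition n k
act φ p v = p (φ ⟨$⟩ˡ v)

𝒜 : ∀ {n k} → CCD n → Partition n k → Partition n k → Set
𝒜 {n} G p q = Σ (Permutation′ n) λ φ → IsAut G φ × (q ≈ₚ act φ p)

recolor : ∀ {n k} → CCD n → (m : ℕ) → (Fin m → Partition n k) → CCD n
recolor {n} {k} G m As = record
  { VColor = VColor G × Vec (Fin k) m
  ; EColor = EColor G
  ; χ      = λ v → (χ G v , tabulate (λ j → As j v))
  ; ε      = ε G
  }

UltrahomogeneousSystem : ∀ {n k} → CCD n → Partition n k → Set
UltrahomogeneousSystem {n} {k} G p =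
  (m : ℕ) (As : Fin m → Partition n k) →
  (∀ j → 𝒜 G p (As j)) → Ultrahomogeneous (recolor G m As)

-- A set S of partitions (up to ≈ₚ) has exactly m elements: an injective
-- enumeration of S by Fin m that hits every element of S.
record Enumeration {n k} (S : Partition n k → Set) (m : ℕ) : Set where
  field
    elem     : Fin m → Partition n k
    elem-in  : ∀ i → S (elem i)
    elem-inj : ∀ i j → elem i ≈ₚ elem j → i ≡ j
    elem-all : ∀ q → S q → ∃ λ i → elem i ≈ₚ q

HasSize : ∀ {n k} → (Partition n k → Set) → ℕ → Set
HasSize S m = Enumeration S m

NonTrivial : ∀ {n k} → CCD n → Partition n k → Set
NonTrivial G p = ¬ HasSize (𝒜 G p) 1

SizeAtMost : ∀ {n k} → (Partition n k → Set) → ℕ → Set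
SizeAtMost S N = ∃ λ m → m ≤ N × HasSize S m

SingletonPart : ∀ {n k} → Partition n k → Fin k → Set
SingletonPart {n} p i = ∃ λ (v : Fin n) → p v ≡ i × (∀ u → p u ≡ i → u ≡ v)

-- The permutation group induced by Aut(G) on 𝒜(A) is the full symmetric
-- group Sym(N): 𝒜(A) has exactly N elements (enumerated by e) and every
-- permutation π of Fin N is induced, i.e. some automorphism φ maps
-- e(i) to e(π i) for all i.
InducedIsFullSym : ∀ {n k} → CCD n → Partition n k → ℕ → Set
InducedIsFullSym {n} G p N =
  Σ (HasSize (𝒜 G p) N) λ e →
    (π : Permutation′ N) → Σ (Permutation′ n) λ φ → IsAut G φ ×
      (∀ i → act φ (Enumeration.elem e i) ≈ₚ Enumeration.elem e (π ⟨$⟩ʳ i))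

{-# OPTIONS --safe #-}
module Submission where

-- Aut(E_n) is the full symmetric group. A colour-preserving partial injection therefore extends,
-- one point at a time by transpositions, to a colour-preserving permutation; since E_n has a
-- single edge colour, every recolouring of E_n is ultrahomogeneous.
--
-- If a map t sends every vertex into another part and has no 2-cycles, then A and the n
-- partitions obtained from A by swapping v with t v are pairwise distinct (the swap of v differs
-- from A exactly at v and t v), so |𝒜(A)| > n. Such a t exists when A has three parts (move to
-- a representative of the cyclically next part) and when A has two parts with at least two
-- vertices each (a 4-cycle a → b → a' → b' → a through both parts). So one of two parts is a
-- singleton {s}; then φ(A) ↦ φ(s) identifies 𝒜(A) with the vertex set, on which Aut(E_n) = Sym(n)
-- acts naturally.

open import Defs
open import Data.Nat using (ℕ; _≤_; suc; s≤s)
open import Data.Fin using (Fin; suc)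
open import Data.Fin.Patterns using (0F; 1F; 2F)
open import Data.Fin.Properties using (_≟_; any?; pigeonhole; <⇒≢; suc-injective; 0≢1+n)
open import Data.Fin.Permutation
  using (Permutation′; _⟨$⟩ʳ_; id; transpose; _∘ₚ_; inverseˡ; inverseʳ)
import Data.Fin.Permutation.Components as PC
open import Data.Product using (Σ; ∃; _×_; _,_; proj₁; proj₂)
open import Data.Sum using (_⊎_; inj₁; inj₂)
open import Data.Empty using (⊥-elim)
open import Function using (_∘_)
open import Function.Bundles using (Injection)
open import Function.Definitions using (Injective)
open import Function.Properties.Inverse using (↔⇒↣)
open import Relation.Nullary using (¬_; yes; no)
open import Relation.Nullary.Decidable using (_×-dec_; ¬?; decidable-stable)
open import Relation.Binary.PropositionalEquality
  using (_≡_; _≢_; refl; sym; trans; cong; subst)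

module _ {n : ℕ} (i j : Fin n) where

  transpose-matchˡ : PC.transpose i j i ≡ j
  transpose-matchˡ with i ≟ i
  ... | yes _   = refl
  ... | no i≢i  = ⊥-elim (i≢i refl)

  transpose-matchʳ : PC.transpose i j j ≡ i
  transpose-matchʳ with j ≟ i
  ... | yes j≡i = j≡i
  ... | no _ with j ≟ j
  ...   | yes _  = refl
  ...   | no j≢j = ⊥-elim (j≢j refl)

  transpose-other : ∀ {k} → k ≢ i → k ≢ j → PC.transpose i j k ≡ k
  transpose-other {k} k≢i k≢j with k ≟ i
  ... | yes k≡i = ⊥-elim (k≢i k≡i)
  ... | no _ with k ≟ j
  ...   | yes k≡j = ⊥-elim (k≢j k≡j)
  ...   | no _    = refl

permutation-injective : ∀ {n} (φ : Permutation′ n) → Injective _≡_ _≡_ (φ ⟨$⟩ʳ_)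
permutation-injective φ = Injection.injective (↔⇒↣ φ)

ColourPreserving : ∀ {n} {C : Set} → (Fin n → C) → Permutation′ n → Set
ColourPreserving c φ = ∀ v → c (φ ⟨$⟩ʳ v) ≡ c v

transpose-colourPreserving : ∀ {n} {C : Set} (c : Fin n → C) {x y : Fin n} →
  c x ≡ c y → ColourPreserving c (transpose x y)
transpose-colourPreserving c {x} {y} cx≡cy v with v ≟ x
... | yes refl = sym cx≡cy
... | no _ with v ≟ y
...   | yes refl = cx≡cy
...   | no _     = refl

extend-colourPreserving : ∀ {n m} {C : Set} (c : Fin n → C) (u w : Fin m → Fin n) →
  Injective _≡_ _≡_ u → Injective _≡_ _≡_ w → (∀ i → c (w i) ≡ c (u i)) →
  Σ (Permutation′ n) λ φ → ColourPreserving c φ × (∀ i → φ ⟨$⟩ʳ u i ≡ w i)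
extend-colourPreserving {m = 0} c u w _ _ _ = id , (λ _ → refl) , λ ()
extend-colourPreserving {m = suc m} c u w u-inj w-inj cw≡cu
  with extend-colourPreserving c (u ∘ suc) (w ∘ suc)
         (suc-injective ∘ u-inj) (suc-injective ∘ w-inj) (cw≡cu ∘ suc)
... | φ , φ-pres , φu≡w = φ ∘ₚ transpose x (w 0F) , ψ-pres , ψu≡w
  where
  x : Fin _
  x = φ ⟨$⟩ʳ u 0F

  ψ-pres : ColourPreserving c (φ ∘ₚ transpose x (w 0F))
  ψ-pres v = trans
    (transpose-colourPreserving c (trans (φ-pres (u 0F)) (sym (cw≡cu 0F))) (φ ⟨$⟩ʳ v))
    (φ-pres v)

  ψu≡w : ∀ i → PC.transpose x (w 0F) (φ ⟨$⟩ʳ u i) ≡ w i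
  ψu≡w 0F      = transpose-matchˡ x (w 0F)
  ψu≡w (suc i) = trans (cong (PC.transpose x (w 0F)) (φu≡w i))
                       (transpose-other x (w 0F) w₁≢x w₁≢w₀)
    where
    w₁≢x : w (suc i) ≢ x
    w₁≢x e = 0≢1+n (sym (u-inj (permutation-injective φ (trans (φu≡w i) e))))
    w₁≢w₀ : w (suc i) ≢ w 0F
    w₁≢w₀ e = 0≢1+n (sym (w-inj e))

constantEdges⇒ultrahomogeneous : ∀ {n} (G : CCD n) →
  (∀ u v u′ v′ → ε G u v ≡ ε G u′ v′) → Ultrahomogeneous G
constantEdges⇒ultrahomogeneous G ε-constant f =
  let φ , φ-pres , φu≡w = extend-colourPreserving (χ G) u w
                            (λ {i} {j} → u-inj i j) (λ {i} {j} → w-inj i j) pres-χ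
  in φ , (φ-pres , λ _ _ _ → ε-constant _ _ _ _) , φu≡w
  where open PartialIso f

ultrahomogeneousSystem-E : ∀ {n k} (A : Partition n k) → UltrahomogeneousSystem (E n) A
ultrahomogeneousSystem-E A m As _ =
  constantEdges⇒ultrahomogeneous (recolor (E _) m As) λ _ _ _ _ → refl

isAut-E : ∀ {n} (φ : Permutation′ n) → IsAut (E n) φ
isAut-E φ = (λ _ → refl) , (λ _ _ _ → refl)

act∈𝒜-E : ∀ {n k} (A : Partition n k) (φ : Permutation′ n) → 𝒜 (E n) A (act φ A)
act∈𝒜-E A φ = φ , isAut-E φ , λ _ → refl

distinct⇒¬sizeAtMost : ∀ {n k N} {S : Partition n k → Set} (f : Fin (suc N) → Partition n k) →
  (∀ i → S (f i)) → (∀ {i j} → f i ≈ₚ f j → i ≡ j) → ¬ SizeAtMost S N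
distinct⇒¬sizeAtMost {N = N} f f∈S f-inj (m , m≤N , e) =
  let i , j , i<j , same-index = pigeonhole (s≤s m≤N) index
  in <⇒≢ i<j (f-inj λ x →
       trans (sym (elem-index i x)) (trans (cong (λ l → elem l x) same-index) (elem-index j x)))
  where
  open Enumeration e
  index : Fin (suc N) → Fin m
  index i = proj₁ (elem-all (f i) (f∈S i))
  elem-index : ∀ i → elem (index i) ≈ₚ f i
  elem-index i = proj₂ (elem-all (f i) (f∈S i))

module _ {n k} (A : Partition n k) (t : Fin n → Fin n)
         (t-crosses : ∀ v → A (t v) ≢ A v) (t²-moves : ∀ v → t (t v) ≢ v) where

  private
    swap : Fin n → Partition n k
    swap v = act (transpose v (t v)) A

    swap-changes : ∀ v → swap v v ≢ A v
    swap-changes v = t-crosses v ∘ trans (sym (cong A (transpose-matchʳ (t v) v)))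

    swap-off : ∀ v {x} → x ≢ v → x ≢ t v → swap v x ≡ A x
    swap-off v x≢v x≢tv = cong A (transpose-other (t v) v x≢tv x≢v)

    changed⇒partner : ∀ v {x} → swap v x ≢ A x → x ≢ v → x ≡ t v
    changed⇒partner v {x} changed x≢v = decidable-stable (x ≟ t v) (changed ∘ swap-off v x≢v)

    swap-injective : ∀ {v w} → swap v ≈ₚ swap w → v ≡ w
    swap-injective {v} {w} same with v ≟ w
    ... | yes v≡w = v≡w
    ... | no v≢w  = ⊥-elim (t²-moves v (trans (cong t (sym w≡tv)) (sym v≡tw)))
      where
      v≡tw : v ≡ t w
      v≡tw = changed⇒partner w (swap-changes v ∘ trans (same v)) v≢w
      w≡tv : w ≡ t v
      w≡tv = changed⇒partner v (swap-changes w ∘ trans (sym (same w))) (v≢w ∘ sym)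

    family : Fin (suc n) → Partition n k
    family 0F      = A
    family (suc v) = swap v

    family∈𝒜 : ∀ i → 𝒜 (E n) A (family i)
    family∈𝒜 0F      = act∈𝒜-E A id
    family∈𝒜 (suc v) = act∈𝒜-E A (transpose v (t v))

    family-injective : ∀ {i j} → family i ≈ₚ family j → i ≡ j
    family-injective {0F}    {0F}    _    = refl
    family-injective {0F}    {suc w} same = ⊥-elim (swap-changes w (sym (same w)))
    family-injective {suc v} {0F}    same = ⊥-elim (swap-changes v (same v))
    family-injective {suc v} {suc w} same = cong suc (swap-injective same)

  crossingMap⇒¬sizeAtMost : ¬ SizeAtMost (𝒜 (E n) A) n
  crossingMap⇒¬sizeAtMost = distinct⇒¬sizeAtMost family family∈𝒜 family-injective

partMap⇒¬sizeAtMost : ∀ {n k} (A : Partition n k) → IsOrderedPartition A →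
  (σ : Fin k → Fin k) → (∀ i → σ i ≢ i) → (∀ i → σ (σ i) ≢ i) → ¬ SizeAtMost (𝒜 (E n) A) n
partMap⇒¬sizeAtMost A isP σ σ-moves σ²-moves = crossingMap⇒¬sizeAtMost A t t-crosses t²-moves
  where
  t : _ → _
  t v = proj₁ (isP (σ (A v)))
  A-t : ∀ v → A (t v) ≡ σ (A v)
  A-t v = proj₂ (isP (σ (A v)))
  t-crosses : ∀ v → A (t v) ≢ A v
  t-crosses v = σ-moves (A v) ∘ trans (sym (A-t v))
  t²-moves : ∀ v → t (t v) ≢ v
  t²-moves v e = σ²-moves (A v) (trans (cong σ (sym (A-t v))) (trans (sym (A-t (t v))) (cong A e)))

next : Fin 3 → Fin 3
next 0F = 1F
next 1F = 2F
next 2F = 0F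

next-moves : ∀ i → next i ≢ i
next-moves 0F ()
next-moves 1F ()
next-moves 2F ()

next²-moves : ∀ i → next (next i) ≢ i
next²-moves 0F ()
next²-moves 1F ()
next²-moves 2F ()

threeParts⇒¬sizeAtMost : ∀ {n} (A : Partition n 3) → IsOrderedPartition A →
  ¬ SizeAtMost (𝒜 (E n) A) n
threeParts⇒¬sizeAtMost A isP = partMap⇒¬sizeAtMost A isP next next-moves next²-moves

module _ {n} (A : Partition n 2) {a a′ b b′ : Fin n}
         (A-a : A a ≡ 0F) (A-a′ : A a′ ≡ 0F) (a′≢a : a′ ≢ a)
         (A-b : A b ≡ 1F) (A-b′ : A b′ ≡ 1F) (b′≢b : b′ ≢ b) where

  private
    part₀≢part₁ : ∀ {x y} → A x ≡ 0F → A y ≡ 1F → x ≢ y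
    part₀≢part₁ A-x A-y refl = 0≢1+n (trans (sym A-x) A-y)

    otherRep : Fin 2 → Fin n
    otherRep 0F = b
    otherRep 1F = a

    otherRep-crosses : ∀ i → A (otherRep i) ≢ i
    otherRep-crosses 0F rewrite A-b = λ ()
    otherRep-crosses 1F rewrite A-a = λ ()

    partner : Fin n → Fin n
    partner v with v ≟ a′ | v ≟ b
    ... | yes _ | _     = b′
    ... | no _  | yes _ = a′
    ... | no _  | no _  = otherRep (A v)

    partner-a′ : partner a′ ≡ b′
    partner-a′ with a′ ≟ a′
    ... | yes _    = refl
    ... | no a′≢a′ = ⊥-elim (a′≢a′ refl)

    partner-b : partner b ≡ a′
    partner-b with b ≟ a′ | b ≟ b
    ... | yes b≡a′ | _       = ⊥-elim (part₀≢part₁ A-a′ A-b (sym b≡a′))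
    ... | no _     | yes _   = refl
    ... | no _     | no b≢b  = ⊥-elim (b≢b refl)

    partner-default : ∀ {v} → v ≢ a′ → v ≢ b → partner v ≡ otherRep (A v)
    partner-default {v} v≢a′ v≢b with v ≟ a′ | v ≟ b
    ... | yes v≡a′ | _       = ⊥-elim (v≢a′ v≡a′)
    ... | no _     | yes v≡b = ⊥-elim (v≢b v≡b)
    ... | no _     | no _    = refl

    partner-otherRep : ∀ {v} → v ≢ a′ → v ≢ b → ∀ i → partner (otherRep i) ≢ v
    partner-otherRep v≢a′ _ 0F e = v≢a′ (trans (sym e) partner-b)
    partner-otherRep _ v≢b 1F e = v≢b (trans (sym e)
      (trans (partner-default (a′≢a ∘ sym) (part₀≢part₁ A-a A-b)) (cong otherRep A-a)))

    partner-crosses : ∀ v → A (partner v) ≢ A v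
    partner-crosses v with v ≟ a′ | v ≟ b
    ... | yes refl | _        rewrite A-a′ | A-b′ = λ ()
    ... | no _     | yes refl rewrite A-a′ | A-b  = λ ()
    ... | no _     | no _     = otherRep-crosses (A v)

    partner²-moves : ∀ v → partner (partner v) ≢ v
    partner²-moves v with v ≟ a′ | v ≟ b
    ... | yes refl | _        = λ e → a′≢a (trans (sym e)
            (trans (partner-default (part₀≢part₁ A-a′ A-b′ ∘ sym) b′≢b) (cong otherRep A-b′)))
    ... | no _     | yes refl = λ e → b′≢b (trans (sym partner-a′) e)
    ... | no v≢a′  | no v≢b   = partner-otherRep v≢a′ v≢b (A v)

  twoLargeParts⇒¬sizeAtMost : ¬ SizeAtMost (𝒜 (E n) A) n
  twoLargeParts⇒¬sizeAtMost = crossingMap⇒¬sizeAtMost A partner partner-crosses partner²-moves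

SingletonPartAt : ∀ {n k} → Partition n k → Fin k → Fin n → Set
SingletonPartAt p i v = p v ≡ i × (∀ u → p u ≡ i → u ≡ v)

singletonPart-or-another : ∀ {n k} (p : Partition n k) {i : Fin k} {v : Fin n} → p v ≡ i →
  SingletonPart p i ⊎ ∃ λ v′ → p v′ ≡ i × v′ ≢ v
singletonPart-or-another p {i} {v} pv≡i with any? (λ u → (p u ≟ i) ×-dec ¬? (u ≟ v))
... | yes another = inj₂ another
... | no ¬another = inj₁ (v , pv≡i , λ u pu≡i →
        decidable-stable (u ≟ v) (λ u≢v → ¬another (u , pu≡i , u≢v)))

act-singletonPartAt : ∀ {n k} {p : Partition n k} {i v} (φ : Permutation′ n) →
  SingletonPartAt p i v → SingletonPartAt (act φ p) i (φ ⟨$⟩ʳ v)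
act-singletonPartAt {p = p} φ (pv≡i , unique) =
  trans (cong p (inverseˡ φ)) pv≡i ,
  λ u pφ⁻¹u≡i → trans (sym (inverseʳ φ)) (cong (φ ⟨$⟩ʳ_) (unique _ pφ⁻¹u≡i))

≢∧≢⇒≡ : ∀ {x y c : Fin 2} → x ≢ c → y ≢ c → x ≡ y
≢∧≢⇒≡ {0F} {0F}      _   _   = refl
≢∧≢⇒≡ {1F} {1F}      _   _   = refl
≢∧≢⇒≡ {0F} {1F} {0F} x≢c _   = ⊥-elim (x≢c refl)
≢∧≢⇒≡ {0F} {1F} {1F} _   y≢c = ⊥-elim (y≢c refl)
≢∧≢⇒≡ {1F} {0F} {0F} _   y≢c = ⊥-elim (y≢c refl)
≢∧≢⇒≡ {1F} {0F} {1F} x≢c _   = ⊥-elim (x≢c refl)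

singletonPartAt-unique : ∀ {n} {p q : Partition n 2} {c j} →
  SingletonPartAt p c j → SingletonPartAt q c j → p ≈ₚ q
singletonPartAt-unique {j = j} (pj≡c , p-unique) (qj≡c , q-unique) x with x ≟ j
... | yes refl = trans pj≡c (sym qj≡c)
... | no x≢j   = ≢∧≢⇒≡ (x≢j ∘ p-unique x) (x≢j ∘ q-unique x)

singletonPart⇒inducedIsFullSym : ∀ {n} (A : Partition n 2) {c} → SingletonPart A c →
  InducedIsFullSym (E n) A n
singletonPart⇒inducedIsFullSym {n} A {c} (s , single) = enumeration , λ π →
  π , isAut-E π , λ i → singletonPartAt-unique
    (act-singletonPartAt π (moved-singletonPartAt i)) (moved-singletonPartAt (π ⟨$⟩ʳ i))
  where
  moved : Fin n → Partition n 2
  moved j = act (transpose s j) A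

  moved-singletonPartAt : ∀ j → SingletonPartAt (moved j) c j
  moved-singletonPartAt j =
    subst (SingletonPartAt (moved j) c) (transpose-matchˡ s j) (act-singletonPartAt (transpose s j) single)

  enumeration : HasSize (𝒜 (E n) A) n
  enumeration = record
    { elem     = moved
    ; elem-in  = act∈𝒜-E A ∘ transpose s
    ; elem-inj = λ i j same → proj₂ (moved-singletonPartAt j) i
                   (trans (sym (same i)) (proj₁ (moved-singletonPartAt i)))
    ; elem-all = λ { q (φ , _ , q≈φA) → φ ⟨$⟩ʳ s , λ x →
                   trans (singletonPartAt-unique (moved-singletonPartAt (φ ⟨$⟩ʳ s))
                                                 (act-singletonPartAt φ single) x)
                         (sym (q≈φA x)) }
    }

twoParts⇒singletonPart : ∀ {n} (A : Partition n 2) → IsOrderedPartition A →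
  SizeAtMost (𝒜 (E n) A) n → ∃ (SingletonPart A)
twoParts⇒singletonPart A isP small
  with singletonPart-or-another A (proj₂ (isP 0F)) | singletonPart-or-another A (proj₂ (isP 1F))
... | inj₁ single | _           = 0F , single
... | inj₂ _      | inj₁ single = 1F , single
... | inj₂ (a′ , A-a′ , a′≢a) | inj₂ (b′ , A-b′ , b′≢b) =
  ⊥-elim (twoLargeParts⇒¬sizeAtMost A (proj₂ (isP 0F)) A-a′ a′≢a (proj₂ (isP 1F)) A-b′ b′≢b small)

sizeAtMost⇒twoParts-singletonPart : ∀ {n k} (A : Partition n k) → IsOrderedPartition A →
  SizeAtMost (𝒜 (E n) A) n → 2 ≤ k → k ≤ 3 →
  k ≡ 2 × (∃ λ (i : Fin k) → SingletonPart A i) × InducedIsFullSym (E n) A n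
sizeAtMost⇒twoParts-singletonPart {k = 2} A isP small _ _ =
  let i , single = twoParts⇒singletonPart A isP small
  in refl , (i , single) , singletonPart⇒inducedIsFullSym A single
sizeAtMost⇒twoParts-singletonPart {k = 3} A isP small _ _ =
  ⊥-elim (threeParts⇒¬sizeAtMost A isP small)
sizeAtMost⇒twoParts-singletonPart {k = 1} _ _ _ (s≤s ()) _
sizeAtMost⇒twoParts-singletonPart {k = suc (suc (suc (suc _)))} _ _ _ _ (s≤s (s≤s (s≤s ())))

mainTheorem11 : (n : ℕ) → 1 ≤ n → (k : ℕ) → (A : Partition n k) → IsOrderedPartition A →
    UltrahomogeneousSystem (E n) A ×
    (NonTrivial (E n) A → SizeAtMost (𝒜 (E n) A) n → 2 ≤ k → k ≤ 3 →
      k ≡ 2 × (∃ λ (i : Fin k) → SingletonPart A i) × InducedIsFullSym (E n) A n)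
mainTheorem11 n _ k A isP =
  ultrahomogeneousSystem-E A , λ _ → sizeAtMost⇒twoParts-singletonPart A isP
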